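{- Let $C_0\ge 1$ be an integer with the following property: for all integers $t\ge 1$ and $k\ge t$, every graph $G$ with $\mathrm{d}(G)\ge C_0k$ and no $K_t$ minor contains a non-empty $k$-connected subgraph $H$ with $|V(H)|\le C_0^2\, t\log^3 t$. Let $t\ge 3$ and $k\ge t$ be integers and let $r=\lceil\sqrt{\log t}\rceil$. Let $G$ be a graph and let $$g(G,t):=\max\left\{\frac{\chi(H)}{t}:\ H\subseteq G,\ |V(H)|\le C_0^2\, t\log^4 t,\ H\text{ has no }K_t\text{ minor}\right\}.$$ If $\chi(G)\ge 4C_0k(1+g(G,t))$ and $G$ contains no $K_t$ minor, then $G$ contains $r$ pairwise vertex-disjoint $k$-connected subgraphs $H_1,\dots,H_r$ with $|V(H_i)|\le C_0^2\, t\log^3 t$ for every $i\in[r]$.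
   Context: All graphs are finite and simple; $\log$ is the natural logarithm; $\chi$ is chromatic number. For a non-empty graph $G$, $\mathrm{d}(G)=|E(G)|/|V(G)|$. A $K_t$ minor is a complete graph on $t$ vertices obtained from a subgraph by contracting edges. (The paper proves that such a constant $C_0$ exists, and states this corollary with $C_0$ being that constant.) -}

module Defs where

open import Data.Nat as ℕ using (ℕ; zero; suc; _+_; _*_; _∸_; _<ᵇ_)
open import Data.Bool using (Bool; true; false; _∧_; if_then_else_)
open import Data.Fin using (Fin; toℕ)
open import Data.Fin.Subset using (Subset; ∣_∣; _∉_)
open import Data.List using (List; map; allFin)
open import Data.Nat.ListAction using (sum)
open import Data.Maybe using (Maybe; just)
open import Data.Integer using (+_)
open import Data.Rational using (ℚ; _/_; 0ℚ; 1ℚ) renaming (_+_ to _+ℚ_; _*_ to _*ℚ_; _≤_ to _≤ℚ_)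
open import Data.Product using (Σ; _×_; ∃)
open import Relation.Binary.PropositionalEquality using (_≡_; _≢_)
open import Relation.Nullary using (¬_)

record Graph (n : ℕ) : Set where
  field
    adj    : Fin n → Fin n → Bool
    sym    : ∀ i j → adj i j ≡ adj j i
    irrefl : ∀ i → adj i i ≡ false
open Graph public

edgeCount : ∀ {n} → Graph n → ℕ
edgeCount {n} G =
  sum (map (λ i → sum (map (λ j → if (toℕ i <ᵇ toℕ j) ∧ adj G i j then 1 else 0)
                          (allFin n)))
           (allFin n))

-- a / b as a rational (b = 0 gives 0; only used with b > 0)
ratio : ℕ → ℕ → ℚ
ratio a zero    = 0ℚ
ratio a (suc b) = (+ a) / suc b

toℚ : ℕ → ℚ
toℚ n = ratio n 1

_^ℚ_ : ℚ → ℕ → ℚ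
q ^ℚ zero  = 1ℚ
q ^ℚ suc e = q *ℚ (q ^ℚ e)

density : ∀ {n} → Graph (suc n) → ℚ
density {n} G = ratio (edgeCount G) (suc n)

-- Natural logarithm of a positive integer t via
--   log t = 2 Σ_{j≥0} y^(2j+1)/(2j+1),   y = (t-1)/(t+1) ∈ [0,1).
-- logLower t m : partial sum over j < m   (increasing, converges up to log t)
-- logUpper t m : logLower t m + 2 y^(2m+1) / ((2m+1)(1-y²))
--               (decreasing, an upper bound, converges down to log t);
--   1/(1-y²) = (t+1)² / (4t).

logY : ℕ → ℚ
logY t = ratio (t ∸ 1) (t + 1)

logLower : ℕ → ℕ → ℚ
logLower t zero    = 0ℚ
logLower t (suc m) = logLower t m +ℚ (toℚ 2 *ℚ ((logY t ^ℚ (2 * m + 1)) *ℚ ratio 1 (2 * m + 1)))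

logUpper : ℕ → ℕ → ℚ
logUpper t m = logLower t m +ℚ
  (toℚ 2 *ℚ ((logY t ^ℚ (2 * m + 1)) *ℚ (ratio 1 (2 * m + 1) *ℚ ratio ((t + 1) * (t + 1)) (4 * t))))

-- m ≤ c · t · (log t)^e   (c·t·x^e is continuous increasing in x ≥ 0, and
-- inf_j logUpper t j = log t, so this is exactly the real inequality)
SizeBound : ℕ → ℕ → ℕ → ℕ → Set
SizeBound c t e m = ∀ j → toℚ m ≤ℚ (toℚ (c * t) *ℚ (logUpper t j ^ℚ e))

-- r² ≥ log t  (sup_j logLower t j = log t)
SqGeLog : ℕ → ℕ → Set
SqGeLog t r = ∀ j → logLower t j ≤ℚ toℚ (r * r)

IsCeilSqrtLog : ℕ → ℕ → Set
IsCeilSqrtLog t r = SqGeLog t r × (∀ r′ → SqGeLog t r′ → r ℕ.≤ r′)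

-- walks from u to w whose vertices after u all satisfy P
data Reach {n} (G : Graph n) (P : Fin n → Set) : Fin n → Fin n → Set where
  here : ∀ {u} → Reach G P u u
  step : ∀ {u v w} → adj G u v ≡ true → P v → Reach G P v w → Reach G P u w

ConnectedOn : ∀ {n} → Graph n → (Fin n → Set) → Set
ConnectedOn G P = ∀ u v → P u → P v → Reach G P u v

KConnected : ∀ {n} → Graph n → ℕ → Set
KConnected {n} G k =
  k ℕ.< n × (∀ (X : Subset n) → ∣ X ∣ ℕ.< k → ConnectedOn G (λ v → v ∉ X))

-- Minors: G has a K_t minor iff there are t disjoint non-empty connected
-- branch sets, pairwise joined by an edge. β v = just a means v lies in
-- branch set a (disjointness is automatic).

HasKMinor : ∀ {n} → Graph n → ℕ → Set
HasKMinor {n} G t =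
  Σ (Fin n → Maybe (Fin t)) λ β →
    (∀ a → ∃ λ v → β v ≡ just a) ×
    (∀ a → ConnectedOn G (λ v → β v ≡ just a)) ×
    (∀ a b → a ≢ b → Σ (Fin n) λ u → Σ (Fin n) λ v →
        β u ≡ just a × β v ≡ just b × adj G u v ≡ true)

Colorable : ∀ {n} → Graph n → ℕ → Set
Colorable {n} G c =
  Σ (Fin n → Fin c) λ f → ∀ i j → adj G i j ≡ true → f i ≢ f j

ChromaticNumber : ∀ {n} → Graph n → ℕ → Set
ChromaticNumber G x = Colorable G x × (∀ c → Colorable G c → x ℕ.≤ c)

record Subgraph {n} (G : Graph n) : Set where
  field
    size    : ℕ
    graph   : Graph size
    emb     : Fin size → Fin n
    emb-inj : ∀ a b → emb a ≡ emb b → a ≡ b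
    emb-adj : ∀ a b → adj graph a b ≡ true → adj G (emb a) (emb b) ≡ true
open Subgraph public

PairwiseVertexDisjoint : ∀ {n r} {G : Graph n} → (Fin r → Subgraph G) → Set
PairwiseVertexDisjoint Hs =
  ∀ i j → i ≢ j → ∀ a b → emb (Hs i) a ≢ emb (Hs j) b

C0Property : ℕ → Set
C0Property C0 =
  ∀ (t k : ℕ) → 1 ℕ.≤ t → t ℕ.≤ k →
  ∀ {n} (G : Graph (suc n)) → toℚ (C0 * k) ≤ℚ density G → ¬ HasKMinor G t →
  Σ (Subgraph G) λ H → 1 ℕ.≤ size H × KConnected (graph H) k
                       × SizeBound (C0 * C0) t 3 (size H)

GAdmissible : ∀ {n} → ℕ → (G : Graph n) → ℕ → Subgraph G → Set
GAdmissible C0 G t H = SizeBound (C0 * C0) t 4 (size H) × ¬ HasKMinor (graph H) t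

IsGValue : ∀ {n} → ℕ → Graph n → ℕ → ℚ → Set
IsGValue C0 G t g =
  (Σ (Subgraph G) λ H → GAdmissible C0 G t H ×
      Σ ℕ λ x → ChromaticNumber (graph H) x × g ≡ ratio x t) ×
  (∀ (H : Subgraph G) → GAdmissible C0 G t H →
      ∀ x → ChromaticNumber (graph H) x → ratio x t ≤ℚ g)

{-# OPTIONS --safe #-}
-- Pieces are found greedily.  While fewer than r have been found, at most (r − 1) C₀² t log³ t
-- vertices are used, and r − 1 ≤ log t, so the used vertices span a graph admissible for g:
-- it is g t-colourable.  As χ(G) > 2C₀k + g t, the unused part is not 2C₀k-colourable, hence
-- (by degeneracy) contains a subgraph of minimum degree ≥ 2C₀k, i.e. of density ≥ C₀k, in which
-- the property of C₀ finds the next small k-connected piece.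
module Submission where

open import Defs renaming (sym to adj-sym; irrefl to adj-irrefl)
open import Data.Nat as ℕ using (ℕ; zero; suc; _+_; _*_; _∸_; z≤n; s≤s; _≤_; _<_; _<ᵇ_)
import Data.Nat.Properties as ℕP
open import Data.Integer as ℤ using (+_)
import Data.Integer.Properties as ℤP
open import Data.Rational as ℚ using (ℚ; 0ℚ; 1ℚ)
  renaming (_+_ to _+ℚ_; _*_ to _*ℚ_; _≤_ to _≤ℚ_; _<_ to _<ℚ_)
import Data.Rational.Properties as ℚP
open import Data.Rational.Unnormalised as ℚᵘ using (mkℚᵘ; *≡*; *≤*)
import Data.Rational.Unnormalised.Properties as ℚᵘP
open import Data.Rational.Solver using (module +-*-Solver)
open import Data.Bool using (Bool; true; false; if_then_else_; _∧_; T)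
import Data.Bool.Properties as BoolP
open import Data.Fin using (Fin; zero; suc; toℕ; punchIn; punchOut; splitAt; join)
import Data.Fin.Properties as FinP
open import Data.List using (map; allFin; tabulate)
import Data.List.Properties as ListP
import Data.Vec.Functional as Vector
import Data.Nat.ListAction as List
open import Algebra.Properties.CommutativeMonoid.Sum ℕP.+-0-commutativeMonoid
  using (sum-syntax; ∑-distrib-+; ∑-comm; sum-cong-≗)
open import Function using (_∘_; id)
open import Function.Definitions using (Injective)
open import Relation.Binary.PropositionalEquality
open import Data.Product as Product using (Σ; _×_; _,_; proj₁; proj₂; ∃)
open import Data.Sum as Sum using (_⊎_; inj₁; inj₂; [_,_]′)
open import Data.Sum.Properties using (inj₁-injective; inj₂-injective)
open import Data.Maybe using (Maybe; just; nothing)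
open import Data.Empty using (⊥; ⊥-elim)
open import Relation.Nullary using (¬_; Dec; yes; no; does; ¬?; contradiction)
open import Relation.Nullary.Decidable using (dec-true; dec-false; decidable-stable; _×-dec_; _→-dec_)
open import Data.Nat.Tactic.RingSolver using (solve-∀)

ratio-toℚᵘ : ∀ a b → ℚ.toℚᵘ (ratio a (suc b)) ℚᵘ.≃ mkℚᵘ (+ a) b
ratio-toℚᵘ a b = ℚP.toℚᵘ-fromℚᵘ (mkℚᵘ (+ a) b)

ratio-mono-≤ : ∀ a b c d → a * suc d ≤ c * suc b → ratio a (suc b) ≤ℚ ratio c (suc d)
ratio-mono-≤ a b c d h = ℚP.toℚᵘ-cancel-≤
  (ℚᵘP.≤-respˡ-≃ (ℚᵘP.≃-sym (ratio-toℚᵘ a b)) (ℚᵘP.≤-respʳ-≃ (ℚᵘP.≃-sym (ratio-toℚᵘ c d))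
    (*≤* (subst₂ ℤ._≤_ (ℤP.pos-* a (suc d)) (ℤP.pos-* c (suc b)) (ℤ.+≤+ h)))))

ratio-cancel-≤ : ∀ a b c d → ratio a (suc b) ≤ℚ ratio c (suc d) → a * suc d ≤ c * suc b
ratio-cancel-≤ a b c d h
  with ℚᵘP.≤-respˡ-≃ (ratio-toℚᵘ a b) (ℚᵘP.≤-respʳ-≃ (ratio-toℚᵘ c d) (ℚP.toℚᵘ-mono-≤ h))
... | *≤* k = ℤP.drop‿+≤+ (subst₂ ℤ._≤_ (sym (ℤP.pos-* a (suc d))) (sym (ℤP.pos-* c (suc b))) k)

ratio-cong : ∀ a b c d → a * suc d ≡ c * suc b → ratio a (suc b) ≡ ratio c (suc d)
ratio-cong a b c d h = ℚP.toℚᵘ-injective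
  (ℚᵘP.≃-trans (ratio-toℚᵘ a b) (ℚᵘP.≃-trans
    (*≡* (trans (sym (ℤP.pos-* a (suc d))) (trans (cong +_ h) (ℤP.pos-* c (suc b)))))
    (ℚᵘP.≃-sym (ratio-toℚᵘ c d))))

ratio-+ : ∀ a b c d → ratio a (suc b) +ℚ ratio c (suc d) ≡ ratio (a * suc d + c * suc b) (suc b * suc d)
ratio-+ a b c d = ℚP.toℚᵘ-injective
  (ℚᵘP.≃-trans (ℚP.toℚᵘ-homo-+ (ratio a (suc b)) (ratio c (suc d)))
  (ℚᵘP.≃-trans (ℚᵘP.+-cong (ratio-toℚᵘ a b) (ratio-toℚᵘ c d))
  (ℚᵘP.≃-trans (ℚᵘP.≃-reflexive (cong (λ z → mkℚᵘ z (d + b * suc d))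
      (trans (cong₂ ℤ._+_ (sym (ℤP.pos-* a (suc d))) (sym (ℤP.pos-* c (suc b))))
             (sym (ℤP.pos-+ (a * suc d) (c * suc b))))))
   (ℚᵘP.≃-sym (ratio-toℚᵘ (a * suc d + c * suc b) (d + b * suc d))))))

ratio-* : ∀ a b c d → ratio a (suc b) *ℚ ratio c (suc d) ≡ ratio (a * c) (suc b * suc d)
ratio-* a b c d = ℚP.toℚᵘ-injective
  (ℚᵘP.≃-trans (ℚP.toℚᵘ-homo-* (ratio a (suc b)) (ratio c (suc d)))
  (ℚᵘP.≃-trans (ℚᵘP.*-cong (ratio-toℚᵘ a b) (ratio-toℚᵘ c d))
  (ℚᵘP.≃-trans (ℚᵘP.≃-reflexive (cong (λ z → mkℚᵘ z (d + b * suc d)) (sym (ℤP.pos-* a c))))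
   (ℚᵘP.≃-sym (ratio-toℚᵘ (a * c) (d + b * suc d))))))

ratio-nonNeg : ∀ a b → 0ℚ ≤ℚ ratio a b
ratio-nonNeg a zero    = ℚP.≤-refl
ratio-nonNeg a (suc b) = ratio-mono-≤ 0 0 a b z≤n

toℚ-+ : ∀ a b → toℚ (a + b) ≡ toℚ a +ℚ toℚ b
toℚ-+ a b = sym (trans (ratio-+ a 0 b 0) (cong toℚ (cong₂ _+_ (ℕP.*-identityʳ a) (ℕP.*-identityʳ b))))

toℚ-mono-≤ : ∀ {a b} → a ≤ b → toℚ a ≤ℚ toℚ b
toℚ-mono-≤ {a} {b} h =
  ratio-mono-≤ a 0 b 0 (subst₂ _≤_ (sym (ℕP.*-identityʳ a)) (sym (ℕP.*-identityʳ b)) h)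

toℚ-cancel-≤ : ∀ {a b} → toℚ a ≤ℚ toℚ b → a ≤ b
toℚ-cancel-≤ {a} {b} h = subst₂ _≤_ (ℕP.*-identityʳ a) (ℕP.*-identityʳ b) (ratio-cancel-≤ a 0 b 0 h)

*-monoˡ-≤-0≤ : ∀ {r p q} → 0ℚ ≤ℚ r → p ≤ℚ q → r *ℚ p ≤ℚ r *ℚ q
*-monoˡ-≤-0≤ {r} h = ℚP.*-monoˡ-≤-nonNeg r {{ℚ.nonNegative h}}

*-monoʳ-≤-0≤ : ∀ {r p q} → 0ℚ ≤ℚ r → p ≤ℚ q → p *ℚ r ≤ℚ q *ℚ r
*-monoʳ-≤-0≤ {r} h = ℚP.*-monoʳ-≤-nonNeg r {{ℚ.nonNegative h}}

*-0≤ : ∀ {p q} → 0ℚ ≤ℚ p → 0ℚ ≤ℚ q → 0ℚ ≤ℚ p *ℚ q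
*-0≤ {p} {q} hp hq = subst (_≤ℚ p *ℚ q) (ℚP.*-zeroʳ p) (*-monoˡ-≤-0≤ hp hq)

≤-+-0≤ : ∀ {p q} → 0ℚ ≤ℚ q → p ≤ℚ p +ℚ q
≤-+-0≤ {p} {q} hq = subst (_≤ℚ p +ℚ q) (ℚP.+-identityʳ p) (ℚP.+-monoʳ-≤ p hq)

^ℚ-0≤ : ∀ {p} e → 0ℚ ≤ℚ p → 0ℚ ≤ℚ p ^ℚ e
^ℚ-0≤ zero    h = ratio-nonNeg 1 1
^ℚ-0≤ (suc e) h = *-0≤ h (^ℚ-0≤ e h)

^ℚ-+ : ∀ p a b → p ^ℚ (a + b) ≡ (p ^ℚ a) *ℚ (p ^ℚ b)
^ℚ-+ p zero    b = sym (ℚP.*-identityˡ _)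
^ℚ-+ p (suc a) b = trans (cong (p *ℚ_) (^ℚ-+ p a b)) (sym (ℚP.*-assoc p _ _))

^ℚ-double : ∀ p n → p ^ℚ (n + n) ≡ (p *ℚ p) ^ℚ n
^ℚ-double p zero    = refl
^ℚ-double p (suc n) = trans (cong (λ e → p *ℚ (p ^ℚ e)) (ℕP.+-suc n n))
  (trans (sym (ℚP.*-assoc p p _)) (cong ((p *ℚ p) *ℚ_) (^ℚ-double p n)))

logTerm : ℕ → ℕ → ℚ
logTerm t m = toℚ 2 *ℚ ((logY t ^ℚ (2 * m + 1)) *ℚ ratio 1 (2 * m + 1))

logTailFactor : ℕ → ℚ
logTailFactor t = ratio ((t + 1) * (t + 1)) (4 * t)

-- With y = (t − 1)/(t + 1):  1 + y² (t + 1)²/4t = ((t − 1)² + 4t)/4t = (t + 1)²/4t.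
logTailFactor-geometric : ∀ T →
  1ℚ +ℚ (logY (suc T) *ℚ logY (suc T)) *ℚ logTailFactor (suc T) ≡ logTailFactor (suc T)
logTailFactor-geometric T = begin
  1ℚ +ℚ (ratio T (suc (T + 1)) *ℚ ratio T (suc (T + 1))) *ℚ ratio N (suc d)
    ≡⟨ cong (λ z → 1ℚ +ℚ z *ℚ ratio N (suc d)) (ratio-* T (T + 1) T (T + 1)) ⟩
  1ℚ +ℚ ratio (T * T) (suc y²) *ℚ ratio N (suc d)
    ≡⟨ cong (1ℚ +ℚ_) (trans (ratio-* (T * T) y² N d) (ratio-cong (T * T * N) _ (T * T) d (y²c-numerator T))) ⟩
  ratio 1 1 +ℚ ratio (T * T) (suc d)
    ≡⟨ ratio-+ 1 0 (T * T) d ⟩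
  ratio (1 * suc d + T * T * 1) (suc (d + 0))
    ≡⟨ ratio-cong (1 * suc d + T * T * 1) (d + 0) N d (1+y²c-numerator T) ⟩
  ratio N (suc d) ∎
  where
  open ≡-Reasoning
  N d y² : ℕ
  N  = (suc T + 1) * (suc T + 1)
  d  = T + 3 * suc T
  y² = (T + 1) + (T + 1) * suc (T + 1)
  y²c-numerator : ∀ T → T * T * ((suc T + 1) * (suc T + 1)) * suc (T + 3 * suc T)
                  ≡ T * T * suc ((T + 3 * suc T) + ((T + 1) + (T + 1) * suc (T + 1)) * suc (T + 3 * suc T))
  y²c-numerator = solve-∀
  1+y²c-numerator : ∀ T → (1 * suc (T + 3 * suc T) + T * T * 1) * suc (T + 3 * suc T)
            ≡ (suc T + 1) * (suc T + 1) * suc (T + 3 * suc T + 0)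
  1+y²c-numerator = solve-∀

module _ (T : ℕ) where
  open +-*-Solver

  private
    t : ℕ
    t = suc T
    y c : ℚ
    y = logY t
    c = logTailFactor t

    y-nonNeg : 0ℚ ≤ℚ y
    y-nonNeg = ratio-nonNeg (t ∸ 1) (t + 1)

    y²-nonNeg : 0ℚ ≤ℚ y *ℚ y
    y²-nonNeg = *-0≤ y-nonNeg y-nonNeg

    2-nonNeg : 0ℚ ≤ℚ toℚ 2
    2-nonNeg = ratio-nonNeg 2 1

    logTerm-nonNeg : ∀ m → 0ℚ ≤ℚ logTerm t m
    logTerm-nonNeg m = *-0≤ 2-nonNeg (*-0≤ (^ℚ-0≤ (2 * m + 1) y-nonNeg) (ratio-nonNeg 1 (2 * m + 1)))

    reciprocal-odd-anti : ∀ j N → ratio 1 (2 * (j + N) + 1) ≤ℚ ratio 1 (2 * j + 1)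
    reciprocal-odd-anti j N = subst₂ _≤ℚ_ (cong (ratio 1) (ℕP.+-comm 1 (2 * (j + N))))
      (cong (ratio 1) (ℕP.+-comm 1 (2 * j)))
      (ratio-mono-≤ 1 (2 * (j + N)) 1 (2 * j)
        (s≤s (ℕP.*-monoʳ-≤ 1 (ℕP.*-monoʳ-≤ 2 (ℕP.m≤m+n j N)))))

    odd-+ : ∀ j N → 2 * (j + N) + 1 ≡ (2 * j + 1) + (N + N)
    odd-+ = solve-∀

    logTerm-shift : ∀ j N → logTerm t (j + N) ≤ℚ logTerm t j *ℚ ((y *ℚ y) ^ℚ N)
    logTerm-shift j N = begin
      toℚ 2 *ℚ ((y ^ℚ (2 * (j + N) + 1)) *ℚ r (j + N))
        ≡⟨ cong (λ z → toℚ 2 *ℚ (z *ℚ r (j + N))) yᵒ ⟩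
      toℚ 2 *ℚ ((yʲ *ℚ qᴺ) *ℚ r (j + N))
        ≤⟨ *-monoˡ-≤-0≤ 2-nonNeg (*-monoˡ-≤-0≤ (*-0≤ (^ℚ-0≤ (2 * j + 1) y-nonNeg) (^ℚ-0≤ N y²-nonNeg))
                                                (reciprocal-odd-anti j N)) ⟩
      toℚ 2 *ℚ ((yʲ *ℚ qᴺ) *ℚ r j)
        ≡⟨ solve 4 (λ 2′ Y Q R → 2′ :* ((Y :* Q) :* R) := (2′ :* (Y :* R)) :* Q)
                   refl (toℚ 2) yʲ qᴺ (r j) ⟩
      logTerm t j *ℚ qᴺ ∎
      where
      open ℚP.≤-Reasoning
      r : ℕ → ℚ
      r m = ratio 1 (2 * m + 1)
      yʲ qᴺ : ℚ
      yʲ = y ^ℚ (2 * j + 1)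
      qᴺ = (y *ℚ y) ^ℚ N
      yᵒ : y ^ℚ (2 * (j + N) + 1) ≡ yʲ *ℚ qᴺ
      yᵒ = trans (cong (y ^ℚ_) (odd-+ j N))
                 (trans (^ℚ-+ y (2 * j + 1) (N + N)) (cong (yʲ *ℚ_) (^ℚ-double y N)))

    logUpper-split : ∀ j → logUpper t j ≡ logLower t j +ℚ logTerm t j *ℚ c
    logUpper-split j = cong (logLower t j +ℚ_)
      (solve 4 (λ 2′ Y R C → 2′ :* (Y :* (R :* C)) := (2′ :* (Y :* R)) :* C) refl
        (toℚ 2) (y ^ℚ (2 * j + 1)) (ratio 1 (2 * j + 1)) c)

    -- Each step replaces the next term by its geometric majorant; since 1 + y² c = c the bound is unchanged.
    logUpper-tail : ∀ j N → logLower t (j + N) +ℚ (logTerm t j *ℚ ((y *ℚ y) ^ℚ N)) *ℚ c ≤ℚ logUpper t j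
    logUpper-tail j zero = subst (λ m → logLower t m +ℚ (logTerm t j *ℚ 1ℚ) *ℚ c ≤ℚ logUpper t j)
      (sym (ℕP.+-identityʳ j)) (ℚP.≤-reflexive
        (trans (cong (λ z → logLower t j +ℚ z *ℚ c) (ℚP.*-identityʳ (logTerm t j))) (sym (logUpper-split j))))
    logUpper-tail j (suc N) =
      subst (λ m → logLower t m +ℚ (logTerm t j *ℚ ((y *ℚ y) ^ℚ suc N)) *ℚ c ≤ℚ logUpper t j)
      (sym (ℕP.+-suc j N)) (ℚP.≤-trans (begin
      L +ℚ logTerm t (j + N) +ℚ (K *ℚ (q *ℚ qᴺ)) *ℚ c
        ≤⟨ ℚP.+-monoˡ-≤ ((K *ℚ (q *ℚ qᴺ)) *ℚ c) (ℚP.+-monoʳ-≤ L (logTerm-shift j N)) ⟩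
      L +ℚ K *ℚ qᴺ +ℚ (K *ℚ (q *ℚ qᴺ)) *ℚ c
        ≡⟨ solve 5 (λ L K Qᴺ Q C → L :+ K :* Qᴺ :+ (K :* (Q :* Qᴺ)) :* C
                                  := L :+ (K :* Qᴺ) :* (con 1ℚ :+ Q :* C)) refl L K qᴺ q c ⟩
      L +ℚ (K *ℚ qᴺ) *ℚ (1ℚ +ℚ q *ℚ c)
        ≡⟨ cong (λ z → L +ℚ (K *ℚ qᴺ) *ℚ z) (logTailFactor-geometric T) ⟩
      L +ℚ (K *ℚ qᴺ) *ℚ c ∎) (logUpper-tail j N))
      where
      open ℚP.≤-Reasoning
      L K q qᴺ : ℚ
      L = logLower t (j + N)
      K = logTerm t j
      q = y *ℚ y
      qᴺ = q ^ℚ N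

    logLower-mono : ∀ j N → logLower t j ≤ℚ logLower t (j + N)
    logLower-mono j zero    = subst (λ m → logLower t j ≤ℚ logLower t m) (sym (ℕP.+-identityʳ j)) ℚP.≤-refl
    logLower-mono j (suc N) = subst (λ m → logLower t j ≤ℚ logLower t m) (sym (ℕP.+-suc j N))
      (ℚP.≤-trans (logLower-mono j N) (≤-+-0≤ (logTerm-nonNeg (j + N))))

  logLower≤logUpper : ∀ j j′ → logLower t j ≤ℚ logUpper t j′
  logLower≤logUpper j j′ = begin
    logLower t j              ≤⟨ subst (λ z → logLower t j ≤ℚ logLower t z) (ℕP.+-comm j j′)
                                       (logLower-mono j j′) ⟩
    logLower t (j′ + j)       ≤⟨ ≤-+-0≤ (*-0≤ (*-0≤ (logTerm-nonNeg j′) (^ℚ-0≤ j y²-nonNeg)) c-nonNeg) ⟩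
    logLower t (j′ + j) +ℚ _  ≤⟨ logUpper-tail j′ j ⟩
    logUpper t j′             ∎
    where
    open ℚP.≤-Reasoning
    c-nonNeg : 0ℚ ≤ℚ c
    c-nonNeg = ratio-nonNeg ((t + 1) * (t + 1)) (4 * t)

  logUpper-nonNeg : ∀ j → 0ℚ ≤ℚ logUpper t j
  logUpper-nonNeg j = ℚP.≤-trans (logLower-mono 0 j) (logLower≤logUpper j j)

-- If log t < r − 1 then r − 1 ≥ 1 would already satisfy (r − 1)² ≥ log t, contradicting minimality of r.
<ceilSqrtLog⇒≤log : ∀ {T r} → IsCeilSqrtLog (suc T) r → ∀ {i} → i < r →
  ∀ j → toℚ i ≤ℚ logUpper (suc T) j
<ceilSqrtLog⇒≤log {T} {suc r′} (sqGeLog , least) {i} (s≤s i≤r′) j =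
  ℚP.≤-trans (toℚ-mono-≤ i≤r′) r′≤L
  where
  L : ℚ
  L = logUpper (suc T) j
  r′≤L : toℚ r′ ≤ℚ L
  r′≤L with toℚ r′ ℚP.≤? L
  ... | yes r′≤L = r′≤L
  ... | no r′≰L = contradiction (least r′ sqGeLog′) (ℕP.<-irrefl refl)
    where
    L<r′ : L <ℚ toℚ r′
    L<r′ = ℚP.≰⇒> r′≰L
    1≤r′ : 1 ≤ r′
    1≤r′ = ℕP.n≢0⇒n>0 λ { refl → ℚP.<-irrefl refl (ℚP.≤-<-trans (logUpper-nonNeg T j) L<r′) }
    sqGeLog′ : SqGeLog (suc T) r′
    sqGeLog′ j₀ = ℚP.≤-trans (logLower≤logUpper T j₀ j) (ℚP.≤-trans (ℚP.<⇒≤ L<r′)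
      (toℚ-mono-≤ (subst (_≤ r′ * r′) (ℕP.*-identityʳ r′) (ℕP.*-monoʳ-≤ r′ 1≤r′))))

ScaledSizeBound : ℕ → ℕ → ℕ → ℕ → ℕ → Set
ScaledSizeBound i c t e m = ∀ j → toℚ m ≤ℚ toℚ i *ℚ (toℚ (c * t) *ℚ (logUpper t j ^ℚ e))

ScaledSizeBound-zero : ∀ {c t e} → ScaledSizeBound 0 c t e 0
ScaledSizeBound-zero {c} {t} {e} j = ℚP.≤-reflexive (sym (ℚP.*-zeroˡ (toℚ (c * t) *ℚ (logUpper t j ^ℚ e))))

ScaledSizeBound-+ : ∀ {i c t e a b} → ScaledSizeBound i c t e a → SizeBound c t e b →
  ScaledSizeBound (suc i) c t e (a + b)
ScaledSizeBound-+ {i} {c} {t} {e} {a} {b} a≤ b≤ j = begin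
  toℚ (a + b)              ≡⟨ toℚ-+ a b ⟩
  toℚ a +ℚ toℚ b           ≤⟨ ℚP.+-mono-≤ (a≤ j) (b≤ j) ⟩
  toℚ i *ℚ B +ℚ B          ≡⟨ solve 2 (λ I B → I :* B :+ B := (con 1ℚ :+ I) :* B) refl (toℚ i) B ⟩
  (1ℚ +ℚ toℚ i) *ℚ B       ≡⟨ cong (_*ℚ B) (sym (toℚ-+ 1 i)) ⟩
  toℚ (suc i) *ℚ B         ∎
  where
  open ℚP.≤-Reasoning
  open +-*-Solver
  B : ℚ
  B = toℚ (c * t) *ℚ (logUpper t j ^ℚ e)

ScaledSizeBound⇒SizeBound : ∀ {T r i c e m} → IsCeilSqrtLog (suc T) r → i < r →
  ScaledSizeBound i c (suc T) e m → SizeBound c (suc T) (suc e) m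
ScaledSizeBound⇒SizeBound {T} {i = i} {c} {e} isCeil i<r m≤ j = ℚP.≤-trans (m≤ j) (begin
  toℚ i *ℚ (X *ℚ Lᵉ) ≤⟨ *-monoʳ-≤-0≤ (*-0≤ (ratio-nonNeg (c * suc T) 1) (^ℚ-0≤ e (logUpper-nonNeg T j)))
                                      (<ceilSqrtLog⇒≤log isCeil i<r j) ⟩
  L *ℚ (X *ℚ Lᵉ)     ≡⟨ solve 3 (λ L X Lᵉ → L :* (X :* Lᵉ) := X :* (L :* Lᵉ)) refl L X Lᵉ ⟩
  X *ℚ (L *ℚ Lᵉ)     ∎)
  where
  open ℚP.≤-Reasoning
  open +-*-Solver
  L X Lᵉ : ℚ
  L = logUpper (suc T) j
  X = toℚ (c * suc T)
  Lᵉ = L ^ℚ e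

toℚ-≤-*-ratio : ∀ a b x T → a * suc T ≤ b → toℚ (a * x) ≤ℚ toℚ b *ℚ ratio x (suc T)
toℚ-≤-*-ratio a b x T h = subst (toℚ (a * x) ≤ℚ_) (sym (ratio-* b 0 x T))
  (ratio-mono-≤ (a * x) 0 (b * x) (T + 0) (subst₂ _≤_ (rearrange a x T) (sym (ℕP.*-identityʳ (b * x)))
    (ℕP.*-monoˡ-≤ x h)))
  where
  rearrange : ∀ a x T → a * suc T * x ≡ a * x * suc (T + 0)
  rearrange = solve-∀

-- x ≤ t g ≤ C₀k g, so 4C₀k(1 + g) ≤ 2C₀k + x would force C₀k = 0.
colourBudget-contradiction : ∀ {C0 k T x χ g} → 1 ≤ C0 → suc T ≤ k →
  toℚ (4 * C0 * k) *ℚ (1ℚ +ℚ g) ≤ℚ toℚ χ → χ ≤ 2 * (C0 * k) + x → ratio x (suc T) ≤ℚ g → ⊥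
colourBudget-contradiction {C0} {k} {T} {x} {χ} {g} 1≤C0 t≤k χ-large χ-small x≤tg =
  ℕP.<⇒≱ (ℕP.m<m+n (2 * K + x) 0<2K+3x) (subst (_≤ 2 * K + x) (split K x) (toℚ-cancel-≤ chain))
  where
  open +-*-Solver
  K : ℕ
  K = C0 * k
  A : ℚ
  A = toℚ (4 * C0 * k)
  split : ∀ K x → 4 * K + 4 * x ≡ (2 * K + x) + (2 * K + 3 * x)
  split = solve-∀
  t≤K : suc T ≤ K
  t≤K = ℕP.m≤n⇒m≤o*n C0 {{ℕ.>-nonZero 1≤C0}} t≤k
  0<2K+3x : 0 < 2 * K + 3 * x
  0<2K+3x = ℕP.≤-trans (ℕP.≤-trans (ℕP.≤-trans (s≤s z≤n) t≤K) (ℕP.m≤n*m K 2))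
                       (ℕP.m≤m+n (2 * K) (3 * x))
  chain : toℚ (4 * K + 4 * x) ≤ℚ toℚ (2 * K + x)
  chain = begin
    toℚ (4 * K + 4 * x)        ≡⟨ trans (cong (λ z → toℚ (z + 4 * x)) (sym (ℕP.*-assoc 4 C0 k)))
                                        (toℚ-+ (4 * C0 * k) (4 * x)) ⟩
    A +ℚ toℚ (4 * x)           ≤⟨ ℚP.+-monoʳ-≤ A (toℚ-≤-*-ratio 4 (4 * C0 * k) x T
                                    (subst (4 * suc T ≤_) (sym (ℕP.*-assoc 4 C0 k)) (ℕP.*-monoʳ-≤ 4 t≤K))) ⟩
    A +ℚ A *ℚ ratio x (suc T)  ≤⟨ ℚP.+-monoʳ-≤ A (*-monoˡ-≤-0≤ (ratio-nonNeg (4 * C0 * k) 1) x≤tg) ⟩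
    A +ℚ A *ℚ g                ≡⟨ solve 2 (λ A g → A :+ A :* g := A :* (con 1ℚ :+ g)) refl A g ⟩
    A *ℚ (1ℚ +ℚ g)             ≤⟨ χ-large ⟩
    toℚ χ                      ≤⟨ toℚ-mono-≤ χ-small ⟩
    toℚ (2 * K + x)            ∎
    where open ℚP.≤-Reasoning

∑-replicate : ∀ n c → ∑[ i < n ] c ≡ n * c
∑-replicate zero    c = refl
∑-replicate (suc n) c = cong (_+_ c) (∑-replicate n c)

∑-mono-≤ : ∀ {n} {f g : Fin n → ℕ} → (∀ i → f i ≤ g i) → ∑[ i < n ] f i ≤ ∑[ i < n ] g i
∑-mono-≤ {zero}  f≤g = z≤n
∑-mono-≤ {suc n} f≤g = ℕP.+-mono-≤ (f≤g zero) (∑-mono-≤ (f≤g ∘ suc))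

sum-tabulate : ∀ {n} (f : Fin n → ℕ) → List.sum (tabulate f) ≡ ∑[ i < n ] f i
sum-tabulate {zero}  f = refl
sum-tabulate {suc n} f = cong (_+_ (f zero)) (sum-tabulate (f ∘ suc))

sum-map-allFin : ∀ n (f : Fin n → ℕ) → List.sum (map f (allFin n)) ≡ ∑[ i < n ] f i
sum-map-allFin n f = trans (cong List.sum (ListP.map-tabulate id f)) (sum-tabulate f)

⟦_⟧ : Bool → ℕ
⟦ b ⟧ = if b then 1 else 0

degree : ∀ {n} → Graph n → Fin n → ℕ
degree {n} G v = ∑[ u < n ] ⟦ adj G v u ⟧

-- Each edge {i, j} is counted once from its smaller endpoint.
adj-split : ∀ {n} (G : Graph n) i j →
  ⟦ adj G i j ⟧ ≡ ⟦ (toℕ i <ᵇ toℕ j) ∧ adj G i j ⟧ + ⟦ (toℕ j <ᵇ toℕ i) ∧ adj G j i ⟧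
adj-split G i j with toℕ i <ᵇ toℕ j in i<j | toℕ j <ᵇ toℕ i in j<i
... | true  | true  = contradiction (ℕP.<ᵇ⇒< (toℕ j) (toℕ i) (subst T (sym j<i) _))
                                    (ℕP.<⇒≯ (ℕP.<ᵇ⇒< (toℕ i) (toℕ j) (subst T (sym i<j) _)))
... | true  | false = sym (ℕP.+-identityʳ _)
... | false | true  = cong ⟦_⟧ (adj-sym G i j)
... | false | false rewrite FinP.toℕ-injective {i = i} {j = j}
        (ℕP.≤-antisym (ℕP.≮⇒≥ (subst T j<i ∘ ℕP.<⇒<ᵇ)) (ℕP.≮⇒≥ (subst T i<j ∘ ℕP.<⇒<ᵇ)))
        | adj-irrefl G j = refl

handshake : ∀ {n} (G : Graph n) → ∑[ v < n ] degree G v ≡ 2 * edgeCount G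
handshake {n} G = begin
  ∑[ i < n ] ∑[ j < n ] ⟦ adj G i j ⟧   ≡⟨ sum-cong-≗ (λ i → trans (sum-cong-≗ (adj-split G i))
                                                              (∑-distrib-+ (forwardEdge i) (backwardEdge i))) ⟩
  ∑[ i < n ] (forward i + backward i)  ≡⟨ ∑-distrib-+ forward backward ⟩
  E + ∑[ i < n ] backward i            ≡⟨ cong (_+_ E) (∑-comm backwardEdge) ⟩
  E + E                                ≡⟨ cong (_+_ E) (sym (ℕP.+-identityʳ E)) ⟩
  2 * E                                ≡⟨ cong (2 *_) E≡edgeCount ⟩
  2 * edgeCount G                      ∎
  where
  open ≡-Reasoning
  forwardEdge backwardEdge : Fin n → Fin n → ℕ
  forwardEdge  i j = ⟦ (toℕ i <ᵇ toℕ j) ∧ adj G i j ⟧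
  backwardEdge i j = ⟦ (toℕ j <ᵇ toℕ i) ∧ adj G j i ⟧
  forward backward : Fin n → ℕ
  forward  i = ∑[ j < n ] forwardEdge i j
  backward i = ∑[ j < n ] backwardEdge i j
  E : ℕ
  E = ∑[ i < n ] forward i
  E≡edgeCount : E ≡ edgeCount G
  E≡edgeCount = sym (trans (sum-map-allFin n _) (sum-cong-≗ (λ i → sum-map-allFin n (forwardEdge i))))

minDegree⇒density : ∀ {m} (H : Graph (suc m)) K → (∀ v → 2 * K ≤ degree H v) → toℚ K ≤ℚ density H
minDegree⇒density {m} H K minDeg =
  ratio-mono-≤ K 0 (edgeCount H) m (subst (K * suc m ≤_) (sym (ℕP.*-identityʳ _)) K*n≤E)
  where
  2Kn≤2E : 2 * (K * suc m) ≤ 2 * edgeCount H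
  2Kn≤2E = subst₂ _≤_ (trans (∑-replicate (suc m) (2 * K)) (rearrange (suc m) K)) (handshake H)
    (∑-mono-≤ minDeg)
    where
    rearrange : ∀ n K → n * (2 * K) ≡ 2 * (K * n)
    rearrange = solve-∀
  K*n≤E : K * suc m ≤ edgeCount H
  K*n≤E = ℕP.*-cancelˡ-≤ 2 2Kn≤2E

induced : ∀ {n m} → Graph n → (Fin m → Fin n) → Graph m
induced G e = record
  { adj    = λ a b → adj G (e a) (e b)
  ; sym    = λ a b → adj-sym G (e a) (e b)
  ; irrefl = λ a → adj-irrefl G (e a)
  }

inducedSubgraph : ∀ {n m} (G : Graph n) (e : Fin m → Fin n) → Injective _≡_ _≡_ e → Subgraph G
inducedSubgraph {m = m} G e e-inj = record
  { size = m ; graph = induced G e ; emb = e ; emb-inj = λ a b → e-inj ; emb-adj = λ a b → id }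

liftSubgraph : ∀ {n m} (G : Graph n) (e : Fin m → Fin n) → Injective _≡_ _≡_ e →
  Subgraph (induced G e) → Subgraph G
liftSubgraph G e e-inj H = record
  { size    = size H
  ; graph   = graph H
  ; emb     = e ∘ emb H
  ; emb-inj = λ a b → emb-inj H a b ∘ e-inj
  ; emb-adj = emb-adj H
  }

record Enumeration {n} (p : Fin n → Bool) : Set where
  field
    count         : ℕ
    elem          : Fin count → Fin n
    elem-injective : Injective _≡_ _≡_ elem
    elem-sound    : ∀ a → p (elem a) ≡ true
    elem-complete : ∀ v → p v ≡ true → ∃ λ a → elem a ≡ v
    count≡∑       : count ≡ ∑[ v < n ] ⟦ p v ⟧

enumerate : ∀ {n} (p : Fin n → Bool) → Enumeration p
enumerate {zero} p = record
  { count = 0 ; elem = λ () ; elem-injective = λ {} ; elem-sound = λ () ; elem-complete = λ () ; count≡∑ = refl }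
enumerate {suc n} p with enumerate (p ∘ suc) | p zero in p0
... | E | true = record
  { count          = suc count
  ; elem           = λ { zero → zero ; (suc a) → suc (elem a) }
  ; elem-injective = λ { {zero} {zero} _ → refl
                       ; {suc a} {suc b} e → cong suc (elem-injective (FinP.suc-injective e)) }
  ; elem-sound     = λ { zero → p0 ; (suc a) → elem-sound a }
  ; elem-complete  = λ { zero _ → zero , refl ; (suc v) pv → Product.map suc (cong suc) (elem-complete v pv) }
  ; count≡∑        = trans (cong suc count≡∑) (cong (λ b → ⟦ b ⟧ + ∑[ v < n ] ⟦ p (suc v) ⟧) (sym p0))
  }
  where open Enumeration E
... | E | false = record
  { count          = count
  ; elem           = suc ∘ elem
  ; elem-injective = elem-injective ∘ FinP.suc-injective
  ; elem-sound     = elem-sound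
  ; elem-complete  = λ { zero p0≡true → contradiction (trans (sym p0) p0≡true) λ ()
                       ; (suc v) pv → Product.map₂ (cong suc) (elem-complete v pv) }
  ; count≡∑        = trans count≡∑ (cong (λ b → ⟦ b ⟧ + ∑[ v < n ] ⟦ p (suc v) ⟧) (sym p0))
  }
  where open Enumeration E

injection⇒≤count : ∀ {m n} (p : Fin n → Bool) (g : Fin m → Fin n) → Injective _≡_ _≡_ g →
  (∀ a → p (g a) ≡ true) → m ≤ ∑[ v < n ] ⟦ p v ⟧
injection⇒≤count p g g-inj pg = subst (_ ≤_) count≡∑ (FinP.injective⇒≤ index-injective)
  where
  open Enumeration (enumerate p)
  index : Fin _ → Fin count
  index a = proj₁ (elem-complete (g a) (pg a))
  index-injective : Injective _≡_ _≡_ index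
  index-injective {a} {b} e = g-inj (trans (sym (proj₂ (elem-complete (g a) (pg a))))
    (trans (cong elem e) (proj₂ (elem-complete (g b) (pg b)))))

InImage : ∀ {s m} → (Fin s → Fin m) → Fin m → Set
InImage e v = ∃ λ a → e a ≡ v

inImage? : ∀ {s m} (e : Fin s → Fin m) v → Dec (InImage e v)
inImage? e v = FinP.any? (λ a → e a FinP.≟ v)

module Complement {s m} (e : Fin s → Fin m) where
  open Enumeration (enumerate (λ v → does (¬? (inImage? e v)))) public

  elem-outside : ∀ b → ¬ InImage e (elem b)
  elem-outside b im = contradiction
    (trans (sym (elem-sound b)) (dec-false (¬? (inImage? e (elem b))) (λ ¬im → ¬im im))) λ ()

  cover : Fin m → Fin s ⊎ Fin count
  cover v with inImage? e v
  ... | yes (a , _) = inj₁ a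
  ... | no ¬im      = inj₂ (proj₁ (elem-complete v (dec-true (¬? (inImage? e v)) ¬im)))

  cover-section : ∀ v → [ e , elem ]′ (cover v) ≡ v
  cover-section v with inImage? e v
  ... | yes (a , ea≡v) = ea≡v
  ... | no ¬im         = proj₂ (elem-complete v (dec-true (¬? (inImage? e v)) ¬im))

  s+count≡m : Injective _≡_ _≡_ e → s + count ≡ m
  s+count≡m e-inj = ℕP.≤-antisym (FinP.injective⇒≤ decode-injective) (FinP.injective⇒≤ encode-injective)
    where
    [e,elem]-injective : Injective _≡_ _≡_ [ e , elem ]′
    [e,elem]-injective {inj₁ a} {inj₁ b} eq = cong inj₁ (e-inj eq)
    [e,elem]-injective {inj₁ a} {inj₂ b} eq = contradiction (a , eq) (elem-outside b)
    [e,elem]-injective {inj₂ a} {inj₁ b} eq = contradiction (b , sym eq) (elem-outside a)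
    [e,elem]-injective {inj₂ a} {inj₂ b} eq = cong inj₂ (elem-injective eq)
    decode : Fin (s + count) → Fin m
    decode = [ e , elem ]′ ∘ splitAt s
    decode-injective : Injective _≡_ _≡_ decode
    decode-injective {x} {y} eq = trans (sym (FinP.join-splitAt s count x))
      (trans (cong (join s count) ([e,elem]-injective {splitAt s x} {splitAt s y} eq))
             (FinP.join-splitAt s count y))
    encode : Fin m → Fin (s + count)
    encode = join s count ∘ cover
    decode-encode : ∀ v → decode (encode v) ≡ v
    decode-encode v = trans (cong [ e , elem ]′ (FinP.splitAt-join s count (cover v))) (cover-section v)
    encode-injective : Injective _≡_ _≡_ encode
    encode-injective {v} {w} eq = trans (sym (decode-encode v)) (trans (cong decode eq) (decode-encode w))

reach-map : ∀ {m n} {H : Graph m} {G : Graph n} {P : Fin m → Set} {Q : Fin n → Set} (e : Fin m → Fin n) →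
  (∀ a b → adj H a b ≡ true → adj G (e a) (e b) ≡ true) → (∀ a → P a → Q (e a)) →
  ∀ {a b} → Reach H P a b → Reach G Q (e a) (e b)
reach-map e hom P⇒Q here              = here
reach-map e hom P⇒Q (step uv Pv walk) = step (hom _ _ uv) (P⇒Q _ Pv) (reach-map e hom P⇒Q walk)

HasKMinor-⊆ : ∀ {n t} {G : Graph n} (H : Subgraph G) → HasKMinor (graph H) t → HasKMinor G t
HasKMinor-⊆ {n} {t} {G} H (β , nonEmpty , connected , touching) = β′ , nonEmpty′ , connected′ , touching′
  where
  β′ : Fin n → Maybe (Fin t)
  β′ v with inImage? (emb H) v
  ... | yes (a , _) = β a
  ... | no _        = nothing

  β′-emb : ∀ a → β′ (emb H a) ≡ β a
  β′-emb a with inImage? (emb H) (emb H a)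
  ... | yes (a′ , eq) = cong β (emb-inj H a′ a eq)
  ... | no ¬im        = contradiction (a , refl) ¬im

  β′-inv : ∀ v x → β′ v ≡ just x → ∃ λ a → emb H a ≡ v × β a ≡ just x
  β′-inv v x β′v≡x with inImage? (emb H) v
  ... | yes (a , eq) = a , eq , β′v≡x

  nonEmpty′ : ∀ x → ∃ λ v → β′ v ≡ just x
  nonEmpty′ x = Product.map (emb H) (trans (β′-emb _)) (nonEmpty x)

  connected′ : ∀ x → ConnectedOn G (λ v → β′ v ≡ just x)
  connected′ x u v βu βv with β′-inv u x βu | β′-inv v x βv
  ... | a , refl , βa | b , refl , βb =
    reach-map (emb H) (emb-adj H) (λ w βw → trans (β′-emb w) βw) (connected x a b βa βb)

  touching′ : ∀ x y → x ≢ y →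
    Σ (Fin n) λ u → Σ (Fin n) λ v → β′ u ≡ just x × β′ v ≡ just y × adj G u v ≡ true
  touching′ x y x≢y with touching x y x≢y
  ... | u , v , βu , βv , uv = emb H u , emb H v , trans (β′-emb u) βu , trans (β′-emb v) βv , emb-adj H u v uv

module _ {m D} (F : Graph (suc m)) (v : Fin (suc m)) (col : Fin m → Fin D) where

  ColourAtNeighbour : Fin D → Set
  ColourAtNeighbour c = ∃ λ u → adj F v (punchIn v u) ≡ true × col u ≡ c

  colourAtNeighbour? : ∀ c → Dec (ColourAtNeighbour c)
  colourAtNeighbour? c = FinP.any? (λ u → (adj F v (punchIn v u) BoolP.≟ true) ×-dec (col u FinP.≟ c))

  -- If every colour sat on a neighbour of v, distinct colours would give distinct neighbours: deg v ≥ D.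
  freeColour : degree F v < D → ∃ λ c → ¬ ColourAtNeighbour c
  freeColour deg<D with FinP.any? (λ c → ¬? (colourAtNeighbour? c))
  ... | yes free  = free
  ... | no noneFree = contradiction (injection⇒≤count (adj F v) neighbour neighbour-injective neighbour-adjacent)
                                    (ℕP.<⇒≱ deg<D)
    where
    taken : ∀ c → ColourAtNeighbour c
    taken c = decidable-stable (colourAtNeighbour? c) (λ ¬taken → noneFree (c , ¬taken))
    neighbour : Fin D → Fin (suc m)
    neighbour c = punchIn v (proj₁ (taken c))
    neighbour-adjacent : ∀ c → adj F v (neighbour c) ≡ true
    neighbour-adjacent c = proj₁ (proj₂ (taken c))
    neighbour-injective : Injective _≡_ _≡_ neighbour
    neighbour-injective {c} {c′} eq = trans (sym (proj₂ (proj₂ (taken c))))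
      (trans (cong col (FinP.punchIn-injective v _ _ eq)) (proj₂ (proj₂ (taken c′))))

  extendColouring : (∀ i j → adj F (punchIn v i) (punchIn v j) ≡ true → col i ≢ col j) →
    ∀ c → ¬ ColourAtNeighbour c → Colorable F D
  extendColouring col-proper c free = colour , colour-proper
    where
    colour : Fin (suc m) → Fin D
    colour w with v FinP.≟ w
    ... | yes _  = c
    ... | no v≢w = col (punchOut v≢w)

    colour-proper : ∀ i j → adj F i j ≡ true → colour i ≢ colour j
    colour-proper i j ij with v FinP.≟ i | v FinP.≟ j
    ... | yes refl | yes refl = contradiction (trans (sym ij) (adj-irrefl F v)) λ ()
    ... | yes refl | no v≢j   = λ c≡ → free (punchOut v≢j ,
                                    trans (cong (adj F v) (FinP.punchIn-punchOut v≢j)) ij , sym c≡)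
    ... | no v≢i   | yes refl = λ ≡c → free (punchOut v≢i ,
                                    trans (cong (adj F v) (FinP.punchIn-punchOut v≢i)) (trans (adj-sym F v i) ij) , ≡c)
    ... | no v≢i   | no v≢j   = col-proper (punchOut v≢i) (punchOut v≢j)
      (trans (cong₂ (adj F) (FinP.punchIn-punchOut v≢i) (FinP.punchIn-punchOut v≢j)) ij)

colourable-extend : ∀ {m D} (F : Graph (suc m)) v → degree F v < D →
  Colorable (induced F (punchIn v)) D → Colorable F D
colourable-extend F v deg<D (col , col-proper) =
  Product.uncurry (extendColouring F v col col-proper) (freeColour F v col deg<D)

HasMinDegreeSubgraph : ∀ {m} → Graph m → ℕ → Set
HasMinDegreeSubgraph {m} F D =
  Σ ℕ λ m′ → Σ (Fin (suc m′) → Fin m) λ e → Injective _≡_ _≡_ e × (∀ a → D ≤ degree (induced F e) a)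

minDegreeSubgraph-or-colourable : ∀ D {m} (F : Graph m) → HasMinDegreeSubgraph F D ⊎ Colorable F D
minDegreeSubgraph-or-colourable D {zero} F = inj₂ ((λ ()) , (λ ()))
minDegreeSubgraph-or-colourable D {suc m} F with FinP.all? (λ v → D ℕP.≤? degree F v)
... | yes highDegree = inj₁ (m , id , id , highDegree)
... | no ¬highDegree with FinP.¬∀⟶∃¬ (suc m) _ (λ v → D ℕP.≤? degree F v) ¬highDegree
...   | v , deg≱D with minDegreeSubgraph-or-colourable D (induced F (punchIn v))
...     | inj₁ (m′ , e , e-inj , minDeg) =
  inj₁ (m′ , punchIn v ∘ e , e-inj ∘ FinP.punchIn-injective v _ _ , minDeg)
...     | inj₂ colouring = inj₂ (colourable-extend F v (ℕP.≰⇒> deg≱D) colouring)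

colourable-cover : ∀ {n m₁ m₂ c₁ c₂} (G : Graph n) (e₁ : Fin m₁ → Fin n) (e₂ : Fin m₂ → Fin n)
  (cover : Fin n → Fin m₁ ⊎ Fin m₂) → (∀ v → [ e₁ , e₂ ]′ (cover v) ≡ v) →
  Colorable (induced G e₁) c₁ → Colorable (induced G e₂) c₂ → Colorable G (c₁ + c₂)
colourable-cover {n} {c₁ = c₁} {c₂} G e₁ e₂ cover section (f₁ , f₁-proper) (f₂ , f₂-proper) =
  colour , colour-proper
  where
  colour : Fin n → Fin (c₁ + c₂)
  colour = join c₁ c₂ ∘ Sum.map f₁ f₂ ∘ cover
  proper : ∀ x y → adj G ([ e₁ , e₂ ]′ x) ([ e₁ , e₂ ]′ y) ≡ true → Sum.map f₁ f₂ x ≢ Sum.map f₁ f₂ y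
  proper (inj₁ a) (inj₁ b) ab eq = f₁-proper a b ab (inj₁-injective eq)
  proper (inj₂ a) (inj₂ b) ab eq = f₂-proper a b ab (inj₂-injective eq)
  proper (inj₁ a) (inj₂ b) ab ()
  proper (inj₂ a) (inj₁ b) ab ()
  colour-proper : ∀ i j → adj G i j ≡ true → colour i ≢ colour j
  colour-proper i j ij eq = proper (cover i) (cover j) (trans (cong₂ (adj G) (section i) (section j)) ij)
    (trans (sym (FinP.splitAt-join c₁ c₂ _)) (trans (cong (splitAt c₁) eq) (FinP.splitAt-join c₁ c₂ _)))

∃-function? : ∀ m c (P : (Fin m → Fin c) → Set) → (∀ {f g} → (∀ i → f i ≡ g i) → P f → P g) →
  (∀ f → Dec (P f)) → Dec (Σ (Fin m → Fin c) P)
∃-function? zero c P resp P? with P? (λ ())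
... | yes p = yes (_ , p)
... | no ¬p = no λ (f , pf) → ¬p (resp (λ ()) pf)
∃-function? (suc m) c P resp P?
  with FinP.any? (λ a → ∃-function? m c (P ∘ (a Vector.∷_))
                           (λ f≗g → resp λ { zero → refl ; (suc i) → f≗g i }) (P? ∘ (a Vector.∷_)))
... | yes (a , f , pf) = yes (_ , pf)
... | no ¬p = no λ (f , pf) → ¬p (f zero , f ∘ suc , resp (λ { zero → refl ; (suc i) → refl }) pf)

colourable? : ∀ {m} (G : Graph m) c → Dec (Colorable G c)
colourable? {m} G c = ∃-function? m c _
  (λ eq proper i j ij e → proper i j ij (trans (eq i) (trans e (sym (eq j)))))
  (λ f → FinP.all? (λ i → FinP.all? (λ j → (adj G i j BoolP.≟ true) →-dec ¬? (f i FinP.≟ f j))))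

leastWitness : (P : ℕ → Set) → (∀ c → Dec (P c)) → ∀ n → P n → Σ ℕ λ x → P x × (∀ c → P c → x ≤ c)
leastWitness P P? zero    p0 = zero , p0 , λ _ _ → z≤n
leastWitness P P? (suc n) pn with P? zero
... | yes p0 = zero , p0 , λ _ _ → z≤n
... | no ¬p0 with leastWitness (P ∘ suc) (P? ∘ suc) n pn
...   | x , px , x-least =
  suc x , px , λ { zero p0 → contradiction p0 ¬p0 ; (suc c) pc → s≤s (x-least c pc) }

chromaticNumber : ∀ {m} (G : Graph m) → Σ ℕ (ChromaticNumber G)
chromaticNumber {m} G = leastWitness (Colorable G) (colourable? G) m
  (id , λ i j ij i≡j → contradiction (trans (sym ij) (trans (cong (adj G i) (sym i≡j)) (adj-irrefl G i))) λ ())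

-- The vertices not covered by the pieces are those in the image of restEmb; used counts the others.
record Packing {n} (G : Graph n) (k c t i : ℕ) : Set where
  field
    piece               : Fin i → Subgraph G
    piece-disjoint      : PairwiseVertexDisjoint piece
    piece-good          : ∀ a → KConnected (graph (piece a)) k × SizeBound c t 3 (size (piece a))
    rest                : ℕ
    restEmb             : Fin rest → Fin n
    restEmb-injective   : Injective _≡_ _≡_ restEmb
    piece-rest-disjoint : ∀ a u w → emb (piece a) u ≢ restEmb w
    used                : ℕ
    rest+used≡n         : rest + used ≡ n
    used-bound          : ScaledSizeBound i c t 3 used

  remainder : Graph rest
  remainder = induced G restEmb

  module UsedPart = Complement restEmb

  usedPart : Subgraph G
  usedPart = inducedSubgraph G UsedPart.elem UsedPart.elem-injective

  size-usedPart : size usedPart ≡ used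
  size-usedPart = ℕP.+-cancelˡ-≡ rest _ _ (trans (UsedPart.s+count≡m restEmb-injective) (sym rest+used≡n))

emptyPacking : ∀ {n} {G : Graph n} {k c t} → Packing G k c t 0
emptyPacking {n} {c = c} {t} = record
  { piece = λ () ; piece-disjoint = λ () ; piece-good = λ ()
  ; rest = n ; restEmb = id ; restEmb-injective = id ; piece-rest-disjoint = λ ()
  ; used = 0 ; rest+used≡n = ℕP.+-identityʳ n ; used-bound = ScaledSizeBound-zero {c} {t} {3} }

addPiece : ∀ {n} {G : Graph n} {k c t i} (P : Packing G k c t i) (H : Subgraph (Packing.remainder P)) →
  KConnected (graph H) k → SizeBound c t 3 (size H) → Packing G k c t (suc i)
addPiece {G = G} {k} {c} {t} {i} P H H-connected H-small = record
  { piece               = piece′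
  ; piece-disjoint      = piece′-disjoint
  ; piece-good          = λ { zero → H-connected , H-small ; (suc a) → piece-good a }
  ; rest                = count
  ; restEmb             = restEmb ∘ elem
  ; restEmb-injective   = elem-injective ∘ restEmb-injective
  ; piece-rest-disjoint = λ { zero u w → elem-outside w ∘ (u ,_) ∘ restEmb-injective
                           ; (suc a) u w → piece-rest-disjoint a u (elem w) }
  ; used                = used + size H
  ; rest+used≡n         = trans (rearrange count used (size H))
                            (trans (cong (_+ used) (s+count≡m (emb-inj H _ _))) rest+used≡n)
  ; used-bound          = ScaledSizeBound-+ {i} {c} {t} {3} {used} {size H} used-bound H-small
  }
  where
  open Packing P
  open Complement (emb H)
  piece′ : Fin (suc i) → Subgraph G
  piece′ zero    = liftSubgraph G restEmb restEmb-injective H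
  piece′ (suc a) = piece a
  piece′-disjoint : PairwiseVertexDisjoint piece′
  piece′-disjoint zero    zero     0≢0 = contradiction refl 0≢0
  piece′-disjoint zero    (suc b)  _   u w = piece-rest-disjoint b w (emb H u) ∘ sym
  piece′-disjoint (suc a) zero     _   u w = piece-rest-disjoint a u (emb H w)
  piece′-disjoint (suc a) (suc b)  a≢b = piece-disjoint a b (a≢b ∘ cong suc)
  rearrange : ∀ c u h → c + (u + h) ≡ (h + c) + u
  rearrange = solve-∀

module _ {C0 k T r n χ g} (1≤C0 : 1 ≤ C0) (C0-prop : C0Property C0) (t≤k : suc T ≤ k)
         (isCeil : IsCeilSqrtLog (suc T) r) (G : Graph n) (χ-is : ChromaticNumber G χ)
         (g-is : IsGValue C0 G (suc T) g) (χ-large : toℚ (4 * C0 * k) *ℚ (1ℚ +ℚ g) ≤ℚ toℚ χ)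
         (noMinor : ¬ HasKMinor G (suc T)) where

  private
    Packing′ : ℕ → Set
    Packing′ = Packing G k (C0 * C0) (suc T)

  packing-grows : ∀ {i} (P : Packing′ i) → HasMinDegreeSubgraph (Packing.remainder P) (2 * (C0 * k)) →
    Packing′ (suc i)
  packing-grows {i} P (m′ , e , e-inj , minDeg) = add (C0-prop (suc T) k (s≤s z≤n) t≤k F
    (minDegree⇒density F (C0 * k) minDeg)
    (noMinor ∘ HasKMinor-⊆ (inducedSubgraph G (restEmb ∘ e) (e-inj ∘ restEmb-injective))))
    where
    open Packing P
    F : Graph (suc m′)
    F = induced remainder e
    add : Σ (Subgraph F) (λ H → 1 ≤ size H × KConnected (graph H) k × SizeBound (C0 * C0) (suc T) 3 (size H)) →
      Packing′ (suc i)
    add (H , _ , H-connected , H-small) = addPiece P (liftSubgraph remainder e e-inj H) H-connected H-small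

  -- The used vertices span a graph admissible for g, so χ(G) ≤ 2C₀k + g t would follow.
  remainder-notColourable : ∀ {i} → i < r → (P : Packing′ i) →
    ¬ Colorable (Packing.remainder P) (2 * (C0 * k))
  remainder-notColourable i<r P remainder-colouring =
    Product.uncurry usedPart-contradiction (chromaticNumber (graph usedPart))
    where
    open Packing P
    usedPart-admissible : GAdmissible C0 G (suc T) usedPart
    usedPart-admissible =
      subst (SizeBound (C0 * C0) (suc T) 4) (sym size-usedPart)
            (ScaledSizeBound⇒SizeBound {c = C0 * C0} {e = 3} {m = used} isCeil i<r used-bound)
      , noMinor ∘ HasKMinor-⊆ usedPart
    usedPart-contradiction : ∀ x → ChromaticNumber (graph usedPart) x → ⊥
    usedPart-contradiction x x-is = colourBudget-contradiction 1≤C0 t≤k χ-large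
      (proj₂ χ-is _ (colourable-cover G restEmb UsedPart.elem UsedPart.cover UsedPart.cover-section
                                      remainder-colouring (proj₁ x-is)))
      (proj₂ g-is usedPart usedPart-admissible x x-is)

  packing : ∀ {i} → i ≤ r → Packing′ i
  packing {zero}  _   = emptyPacking
  packing {suc i} i<r = [ packing-grows P , ⊥-elim ∘ remainder-notColourable i<r P ]′
    (minDegreeSubgraph-or-colourable (2 * (C0 * k)) (Packing.remainder P))
    where
    P : Packing′ i
    P = packing (ℕP.<⇒≤ i<r)

corollary6p1 : (C0 : ℕ) → 1 ≤ C0 → C0Property C0 →
    (t k : ℕ) → 3 ≤ t → t ≤ k → (r : ℕ) → IsCeilSqrtLog t r →
    ∀ {n} (G : Graph n) → (χG : ℕ) → ChromaticNumber G χG →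
    (g : ℚ) → IsGValue C0 G t g →
    toℚ (4 * C0 * k) *ℚ (1ℚ +ℚ g) ≤ℚ toℚ χG → ¬ HasKMinor G t →
    Σ (Fin r → Subgraph G) λ Hs → PairwiseVertexDisjoint Hs ×
      (∀ i → KConnected (graph (Hs i)) k × SizeBound (C0 * C0) t 3 (size (Hs i)))
corollary6p1 C0 _ _ zero k () _ _ _ _ _ _ _ _ _ _
corollary6p1 C0 1≤C0 C0-prop (suc T) k _ t≤k r isCeil G χ χ-is g g-is χ-large noMinor =
  piece , piece-disjoint , piece-good
  where open Packing (packing 1≤C0 C0-prop t≤k isCeil G χ-is g-is χ-large noMinor ℕP.≤-refl)
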